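{- For every prime $p\geq 5$ and every integer $\alpha\geq 1$, $rb(\mathbb{Z}_{p^\alpha},p)\geq \frac{p+1}{2}+1$.
   Context: $\mathbb{Z}_n$ denotes the cyclic group of order $n$. An $r$-coloring of $\mathbb{Z}_n$ is a surjective map $c:\mathbb{Z}_n\to\{1,\dots,r\}$. For a fixed integer $k$, a triple is any $(x_1,x_2,x_3)\in\mathbb{Z}_n^3$ with $x_1+x_2\equiv kx_3 \pmod n$. A triple is rainbow under $c$ if $c(x_1),c(x_2),c(x_3)$ are pairwise distinct; $c$ is rainbow-free if no triple is rainbow. The rainbow number $rb(\mathbb{Z}_n,k)$ is the smallest positive integer $r$ such that every $r$-coloring of $\mathbb{Z}_n$ admits a rainbow triple (by convention $rb(\mathbb{Z}_n,k)=n+1$ if no such $r$ exists). -}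

module Defs where

open import Data.Nat using (ℕ; zero; suc; _+_; _*_; _%_; _≤_; _<_; NonZero)
open import Data.Fin using (Fin; toℕ)
open import Data.Product using (Σ; ∃; _×_; _,_)
open import Data.Empty using (⊥)
open import Relation.Nullary using (¬_)
open import Relation.Binary.PropositionalEquality using (_≡_; _≢_)

-- ℤ_n is represented by Fin n; two elements are compared via their
-- canonical representatives in {0,…,n-1}.

Surjective : ∀ {n r} → (Fin n → Fin r) → Set
Surjective {n} {r} c = (j : Fin r) → ∃ λ (x : Fin n) → c x ≡ j

IsTriple : (n k : ℕ) → .{{_ : NonZero n}} → Fin n → Fin n → Fin n → Set
IsTriple n k x₁ x₂ x₃ = (toℕ x₁ + toℕ x₂) % n ≡ (k * toℕ x₃) % n

Rainbow : ∀ {n r} → (Fin n → Fin r) → Fin n → Fin n → Fin n → Set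
Rainbow c x₁ x₂ x₃ = (c x₁ ≢ c x₂) × (c x₁ ≢ c x₃) × (c x₂ ≢ c x₃)

HasRainbowTriple : (n k : ℕ) → .{{_ : NonZero n}} → ∀ {r} → (Fin n → Fin r) → Set
HasRainbowTriple n k c =
  Σ (Fin n) λ x₁ → Σ (Fin n) λ x₂ → Σ (Fin n) λ x₃ →
    IsTriple n k x₁ x₂ x₃ × Rainbow c x₁ x₂ x₃

AllColouringsRainbow : (n k r : ℕ) → .{{_ : NonZero n}} → Set
AllColouringsRainbow n k r =
  (c : Fin n → Fin r) → Surjective c → HasRainbowTriple n k c

IsRainbowNumber : (n k m : ℕ) → .{{_ : NonZero n}} → Set
IsRainbowNumber n k m =
  (1 ≤ m × AllColouringsRainbow n k m
     × ((r : ℕ) → 1 ≤ r → r < m → ¬ AllColouringsRainbow n k r))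
  ⊎' (((r : ℕ) → 1 ≤ r → ¬ AllColouringsRainbow n k r) × m ≡ n + 1)
  where
    open import Data.Sum using () renaming (_⊎_ to _⊎'_)

module Submission where

-- Idea: reduce modulo p and fold ℤ_p onto {0,…,⌊p/2⌋} by a ↦ min(a, p − a),
-- the distance from a to the nearest multiple of p.  Since p ∣ n and p ∣ p·x₃,
-- every triple x₁ + x₂ ≡ p·x₃ (mod n) has x₁ ≡ −x₂ (mod p), and the fold is
-- invariant under negation; so x₁ and x₂ always receive the same colour.
-- Truncating the fold at r − 1 gives a surjective rainbow-free r-colouring
-- as long as 2(r − 1) < p, i.e. r ≤ (p+1)/2.  Hence no r ≤ (p+1)/2 has the
-- rainbow property, and the rainbow number exceeds (p+1)/2.

open import Defs
open import Data.Nat using (ℕ; suc; _+_; _^_; _/_; _≤_; NonZero)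
open import Data.Nat.Primality using (Prime; prime⇒nonZero)
open import Data.Nat.Properties using (m^n≢0)

open import Data.Nat using (_*_; _%_; _∸_; _⊓_; _<_; s≤s; z≤n; _≤?_; _<?_)
open import Data.Nat.Properties
open import Data.Nat.DivMod
open import Data.Nat.Divisibility using (_∣_; divides; ∣⇒≤; ∣-refl; ∣-trans; m%n≡0⇒n∣m; n∣m⇒m%n≡0)
open import Data.Fin using (Fin; toℕ; fromℕ<)
open import Data.Fin.Properties using (toℕ-fromℕ<; toℕ-injective; toℕ≤pred[n])
open import Data.Product using (_,_)
open import Data.Sum using (_⊎_; inj₁; inj₂)
open import Data.Empty using (⊥-elim)
open import Relation.Nullary using (¬_; yes; no)
open import Relation.Binary.PropositionalEquality
open ≡-Reasoning

fold : ℕ → ℕ → ℕ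
fold p a = a ⊓ (p ∸ a)

residues-summing-to-zero : ∀ p .{{_ : NonZero p}} a b → a < p → b < p →
  (a + b) % p ≡ 0 → a + b ≡ 0 ⊎ a + b ≡ p
residues-summing-to-zero p a b a<p b<p a+b≡0 with m%n≡0⇒n∣m (a + b) p a+b≡0
... | divides q a+b≡q*p with q <? 2
...   | no q≮2 = ⊥-elim (q≮2 (*-cancelʳ-< p q 2 (subst (_< 2 * p) a+b≡q*p a+b<2p)))
  where
    a+b<2p : a + b < 2 * p
    a+b<2p = subst (a + b <_) (cong (p +_) (sym (+-identityʳ p))) (+-mono-< a<p b<p)
residues-summing-to-zero p a b a<p b<p a+b≡0 | divides 0 a+b≡0*p | yes _ = inj₁ a+b≡0*p
residues-summing-to-zero p a b a<p b<p a+b≡0 | divides 1 a+b≡1*p | yes _ =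
  inj₂ (trans a+b≡1*p (+-identityʳ p))
residues-summing-to-zero p a b a<p b<p a+b≡0 | divides (suc (suc _)) _ | yes (s≤s (s≤s ()))

fold-negation : ∀ p .{{_ : NonZero p}} a b → (a + b) % p ≡ 0 →
  fold p (a % p) ≡ fold p (b % p)
fold-negation p a b a+b≡0
  with residues-summing-to-zero p (a % p) (b % p) (m%n<n a p) (m%n<n b p)
         (trans (sym (%-distribˡ-+ a b p)) a+b≡0)
... | inj₁ sum≡0 =
  cong (fold p) (trans (m+n≡0⇒m≡0 (a % p) sum≡0) (sym (m+n≡0⇒n≡0 (a % p) sum≡0)))
... | inj₂ sum≡p = begin
  (a % p) ⊓ (p ∸ a % p)  ≡⟨ cong ((a % p) ⊓_) (complement (a % p) (b % p) sum≡p) ⟩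
  (a % p) ⊓ (b % p)      ≡⟨ ⊓-comm (a % p) (b % p) ⟩
  (b % p) ⊓ (a % p)      ≡⟨ cong ((b % p) ⊓_) (sym (complement (b % p) (a % p)
                              (trans (+-comm (b % p) (a % p)) sum≡p))) ⟩
  (b % p) ⊓ (p ∸ b % p)  ∎
  where
    complement : ∀ u v → u + v ≡ p → p ∸ u ≡ v
    complement u v u+v≡p = trans (cong (_∸ u) (sym u+v≡p)) (m+n∸m≡n u v)

fold-lower-half : ∀ p a → a + a ≤ p → fold p a ≡ a
fold-lower-half p a 2a≤p = m≤n⇒m⊓n≡m (m+n≤o⇒m≤o∸n a 2a≤p)

triple-sum-divisible : ∀ n k d .{{_ : NonZero n}} .{{_ : NonZero d}} → d ∣ n → d ∣ k →
  ∀ x₁ x₂ x₃ → IsTriple n k x₁ x₂ x₃ → (toℕ x₁ + toℕ x₂) % d ≡ 0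
triple-sum-divisible n k d d∣n d∣k x₁ x₂ x₃ triple = begin
  (toℕ x₁ + toℕ x₂) % d      ≡⟨ sym (m∣n⇒o%n%m≡o%m d n _ d∣n) ⟩
  (toℕ x₁ + toℕ x₂) % n % d  ≡⟨ cong (_% d) triple ⟩
  (k * toℕ x₃) % n % d       ≡⟨ m∣n⇒o%n%m≡o%m d n _ d∣n ⟩
  (k * toℕ x₃) % d           ≡⟨ n∣m⇒m%n≡0 _ d (∣-trans d∣k (divides (toℕ x₃) (*-comm k (toℕ x₃)))) ⟩
  0                          ∎

module FoldColouring (p n : ℕ) .{{_ : NonZero p}} .{{_ : NonZero n}} (p∣n : p ∣ n) where

  colour : (r : ℕ) → Fin n → Fin (suc r)
  colour r x = fromℕ< (s≤s (m⊓n≤n (fold p (toℕ x % p)) r))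

  colour-value : ∀ r x → toℕ (colour r x) ≡ fold p (toℕ x % p) ⊓ r
  colour-value r x = toℕ-fromℕ< _

  -- Every colour j ≤ r is attained, at the element j itself, provided 2r < p.
  colour-surjective : ∀ r → r + r < p → Surjective (colour r)
  colour-surjective r 2r<p j = x , toℕ-injective (trans (colour-value r x) value≡j)
    where
      j≤r : toℕ j ≤ r
      j≤r = toℕ≤pred[n] j
      2j<p : toℕ j + toℕ j < p
      2j<p = ≤-<-trans (+-mono-≤ j≤r j≤r) 2r<p
      j<p : toℕ j < p
      j<p = ≤-<-trans (m≤m+n (toℕ j) (toℕ j)) 2j<p
      x : Fin n
      x = fromℕ< (≤-trans j<p (∣⇒≤ p∣n))
      value≡j : fold p (toℕ x % p) ⊓ r ≡ toℕ j
      value≡j = begin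
        fold p (toℕ x % p) ⊓ r  ≡⟨ cong (λ y → fold p (y % p) ⊓ r) (toℕ-fromℕ< _) ⟩
        fold p (toℕ j % p) ⊓ r  ≡⟨ cong (λ y → fold p y ⊓ r) (m<n⇒m%n≡m j<p) ⟩
        fold p (toℕ j) ⊓ r      ≡⟨ cong (_⊓ r) (fold-lower-half p (toℕ j) (<⇒≤ 2j<p)) ⟩
        toℕ j ⊓ r               ≡⟨ m≤n⇒m⊓n≡m j≤r ⟩
        toℕ j                   ∎

  -- The two summands of a triple for k = p always share their colour.
  colour-rainbow-free : ∀ r → ¬ HasRainbowTriple n p (colour r)
  colour-rainbow-free r (x₁ , x₂ , x₃ , triple , c₁≢c₂ , _) =
    c₁≢c₂ (toℕ-injective (begin
      toℕ (colour r x₁)          ≡⟨ colour-value r x₁ ⟩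
      fold p (toℕ x₁ % p) ⊓ r    ≡⟨ cong (_⊓ r) (fold-negation p (toℕ x₁) (toℕ x₂) x₁+x₂≡0) ⟩
      fold p (toℕ x₂ % p) ⊓ r    ≡⟨ sym (colour-value r x₂) ⟩
      toℕ (colour r x₂)          ∎))
    where
      x₁+x₂≡0 : (toℕ x₁ + toℕ x₂) % p ≡ 0
      x₁+x₂≡0 = triple-sum-divisible n p p p∣n ∣-refl x₁ x₂ x₃ triple

  not-all-rainbow : ∀ r → r + r < p → ¬ AllColouringsRainbow n p (suc r)
  not-all-rainbow r 2r<p allRainbow =
    colour-rainbow-free r (allRainbow (colour r) (colour-surjective r 2r<p))

rainbowNumber-above : ∀ n k m q .{{_ : NonZero n}} → q ≤ n →
  (∀ r → 1 ≤ r → r ≤ q → ¬ AllColouringsRainbow n k r) →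
  IsRainbowNumber n k m → q < m
rainbowNumber-above n k m q q≤n _ (inj₂ (_ , refl)) = subst (q <_) (+-comm 1 n) (s≤s q≤n)
rainbowNumber-above n k m q q≤n noRainbow (inj₁ (1≤m , allRainbow , _)) with m ≤? q
... | yes m≤q = ⊥-elim (noRainbow m 1≤m m≤q allRainbow)
... | no m≰q  = ≰⇒> m≰q

half-succ-double : ∀ p → (p + 1) / 2 + (p + 1) / 2 ≤ p + 1
half-succ-double p = subst (_≤ p + 1) (trans (*-comm h 2) (cong (h +_) (+-identityʳ h)))
                       (m/n*n≤m (p + 1) 2)
  where h = (p + 1) / 2

half-succ-≤ : ∀ p .{{_ : NonZero p}} → (p + 1) / 2 ≤ p
half-succ-≤ p = ≤-pred (subst (suc ((p + 1) / 2) ≤_) (+-comm p 1)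
                  (m/n<m (p + 1) 2 {{p+1≢0}} (s≤s (s≤s z≤n))))
  where
    p+1≢0 : NonZero (p + 1)
    p+1≢0 = subst NonZero (+-comm 1 p) _

proposition6 : (p α : ℕ) → (pp : Prime p) → 5 ≤ p → 1 ≤ α →
    (m : ℕ) → IsRainbowNumber (p ^ α) p m {{m^n≢0 p α {{prime⇒nonZero pp}}}} →
    (p + 1) / 2 + 1 ≤ m
proposition6 p (suc α) pp _ _ m isRainbowNumber =
  subst (_≤ m) (+-comm 1 h)
    (rainbowNumber-above n p m h (≤-trans (half-succ-≤ p) (∣⇒≤ p∣n)) noRainbow isRainbowNumber)
  where
    instance
      p≢0 : NonZero p
      p≢0 = prime⇒nonZero pp
      n≢0 : NonZero (p ^ suc α)
      n≢0 = m^n≢0 p (suc α)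
    n = p ^ suc α
    h = (p + 1) / 2
    p∣n : p ∣ n
    p∣n = divides (p ^ α) (*-comm p (p ^ α))
    -- r = r' + 1 ≤ h gives 2r ≤ p + 1, i.e. 2r' < p.
    noRainbow : ∀ r → 1 ≤ r → r ≤ h → ¬ AllColouringsRainbow n p r
    noRainbow (suc r') _ r≤h = FoldColouring.not-all-rainbow p n p∣n r' 2r'<p
      where
        2r'<p : r' + r' < p
        2r'<p = ≤-pred (subst₂ _≤_ (cong suc (+-suc r' r')) (+-comm p 1)
                  (≤-trans (+-mono-≤ r≤h r≤h) (half-succ-double p)))
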